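{- In F-MMB, the number of hash computations performed during the append operation that produces the structure with $n$ leaves is at most $\lfloor\log_2(n+1)\rfloor+1$, and its amortized value $\lim_{N\to\infty}\frac1N\sum_{n=1}^{N}c(n)$, where $c(n)$ is this number, equals $3$.
   Context: A mountain of height $s\ge0$ is a perfect binary tree with $2^s$ leaves; its root is its peak. The U-MMB with $n$ leaves is an ordered (left-to-right) list of mountains whose leaves read left to right are $h_1,\dots,h_n$, built inductively from the empty list: the $n$-th append (1, add step) adds $h_n$ as a height-0 mountain at the right end, and (2, merge step) if there exist two consecutive mountains of equal height, takes the rightmost such pair, of height $s$, and replaces it in place by a mountain of height $s+1$ whose new peak (the merge peak) has the two old peaks as children. F-MMB additionally forward-bags the peaks $P_1,\dots,P_t$ (left to right): range nodes $R_1$ (single child $P_1$) and $R_j$ with children $R_{j-1},P_j$; the root is $R_t$. The F-MMB append consists of the add and merge steps followed by a bag step: if there was a merge step, all range nodes above and to the right of the merge peak (i.e., $R_j$ for all $j$ at least the index of the merge peak) are recomputed; otherwise a new range node above the new leaf is created. Hash computations counted: the merge peak (if any) plus each range node created or recomputed; leaf hashes are not counted. -}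

module Defs where

open import Data.Nat using (ℕ; zero; suc; _+_; _≟_)
open import Data.List using (List; []; _∷_; _∷ʳ_; length)
open import Data.Maybe using (Maybe; just; nothing)
open import Data.Product using (_×_; _,_)
open import Relation.Nullary using (yes; no)
open import Data.Integer using (+_)
open import Data.Rational using (ℚ; _/_)

-- A U-MMB / F-MMB is determined (up to the labels of its leaves) by the
-- left-to-right list of the heights of its mountains.
Heights : Set
Heights = List ℕ

-- Merge step: find the RIGHTMOST pair of consecutive mountains of equal
-- height s and replace it in place by a mountain of height s+1.
-- Returns the new list together with the number k of peaks at or to the right
-- of the merge peak, i.e. the number of range nodes R_j with j ≥ (index of the
-- merge peak) = t - i + 1 (t peaks, merge peak P_i). 'nothing' if no such pair.
mergeStep : Heights → Maybe (Heights × ℕ)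
mergeStep [] = nothing
mergeStep (x ∷ xs) with mergeStep xs
... | just (ys , k) = just (x ∷ ys , k)
... | nothing with xs
...   | [] = nothing
...   | y ∷ zs with x ≟ y
...     | yes _ = just (suc x ∷ zs , suc (length zs))
...     | no _ = nothing

-- Result: new structure and number of hash computations:
--  * with a merge: 1 (merge peak) + k (recomputed range nodes R_j, j ≥ i);
--  * without a merge: 1 (the new range node above the new leaf).
append : Heights → Heights × ℕ
append hs with mergeStep (hs ∷ʳ 0)
... | just (ys , k) = ys , suc k
... | nothing = hs ∷ʳ 0 , 1

mmb : ℕ → Heights
mmb zero = []
mmb (suc n) with append (mmb n)
... | (hs , _) = hs

cost : ℕ → ℕ
cost zero = 0
cost (suc n) with append (mmb n)
... | (_ , c) = c

totalCost : ℕ → ℕ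
totalCost zero = 0
totalCost (suc N) = totalCost N + cost (suc N)

average : ℕ → ℚ
average M = (+ totalCost (suc M)) / suc M

-- The mountains of the MMB with n leaves are read off the binary expansion
-- 1 b₁ … b_K of n + 1: there are K of them, the i-th of height b_i + K − i.
-- An append increments this counter. If some bit is 0, the last 0 and the j
-- ones after it become 1 0 … 0; the mountain at the last 0 and its right
-- neighbour (possibly the new leaf) have equal height, so this is the merge
-- step, and it costs j + 2 ≤ K + 1 hashes. If all bits are 1, the counter
-- overflows to K + 1 zeros and the append costs 1.
-- Against the potential Φ = (number of ones) + Σ_{i ≤ K} (i + 1) every append
-- costs exactly 3 − ΔΦ, so Σ_{n ≤ N} c(n) = 3 N − Φ, and Φ = O(log² N).
module Submission where

module BinaryCounter where
  open import Defs
  open import Data.Bool using (Bool; true; false)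
  open import Data.List using (List; []; _∷_; _∷ʳ_; _++_; length; replicate; downFrom)
  open import Data.List.Properties using (length-++; length-replicate; length-downFrom)
  open import Data.Maybe using (just; nothing)
  open import Data.Nat
  open import Data.Nat.Properties
  open import Data.Nat.Logarithm using (⌊log₂_⌋; ⌊log₂⌋-mono-≤; ⌊log₂[2^n]⌋≡n)
  open import Data.Nat.Tactic.RingSolver using (solve-∀)
  open import Data.Product using (_×_; _,_; proj₁; proj₂; ∃-syntax)
  open import Relation.Binary.PropositionalEquality
  open import Relation.Nullary.Decidable using (dec-no)

  mergeStep-∷-just : ∀ x xs {ys k} → mergeStep xs ≡ just (ys , k) →
                     mergeStep (x ∷ xs) ≡ just (x ∷ ys , k)
  mergeStep-∷-just x xs eq rewrite eq = refl

  mergeStep-∷-nothing : ∀ x y zs → x ≢ y → mergeStep (y ∷ zs) ≡ nothing →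
                        mergeStep (x ∷ y ∷ zs) ≡ nothing
  mergeStep-∷-nothing x y zs x≢y eq rewrite eq | dec-no (x ≟ y) x≢y = refl

  mergeStep-pair : ∀ y zs → mergeStep (y ∷ zs) ≡ nothing →
                   mergeStep (y ∷ y ∷ zs) ≡ just (suc y ∷ zs , suc (length zs))
  mergeStep-pair y zs eq rewrite eq | ≟-diag {y} {y} refl = refl

  mergeStep-downFrom : ∀ n → mergeStep (downFrom n) ≡ nothing
  mergeStep-downFrom zero = refl
  mergeStep-downFrom (suc zero) = refl
  mergeStep-downFrom (suc (suc n)) =
    mergeStep-∷-nothing (suc n) n (downFrom n) 1+n≢n (mergeStep-downFrom (suc n))

  bit : Bool → ℕ
  bit false = 0
  bit true = 1

  ones zeros : ℕ → List Bool
  ones j = replicate j true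
  zeros j = replicate j false

  length-zeros≡length-ones : ∀ j → length (zeros j) ≡ length (ones j)
  length-zeros≡length-ones j = trans (length-replicate j) (sym (length-replicate j))

  length-carry : ∀ xs j → length (xs ++ true ∷ zeros j) ≡ length (xs ++ false ∷ ones j)
  length-carry xs j = begin
    length (xs ++ true ∷ zeros j)      ≡⟨ length-++ xs ⟩
    length xs + suc (length (zeros j))
      ≡⟨ cong (λ l → length xs + suc l) (length-zeros≡length-ones j) ⟩
    length xs + suc (length (ones j))  ≡⟨ length-++ xs ⟨
    length (xs ++ false ∷ ones j)      ∎
    where open ≡-Reasoning

  -- Bit lists are written most significant bit first.
  heights : List Bool → Heights
  heights [] = []
  heights (b ∷ bs) = bit b + length bs ∷ heights bs

  heights-zeros : ∀ j → heights (zeros j) ≡ downFrom j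
  heights-zeros zero = refl
  heights-zeros (suc j) = cong₂ _∷_ (length-replicate j) (heights-zeros j)

  heights-ones-∷ʳ-0 : ∀ j → heights (ones j) ∷ʳ 0 ≡ downFrom (suc j)
  heights-ones-∷ʳ-0 zero = refl
  heights-ones-∷ʳ-0 (suc j) = cong₂ _∷_ (cong suc (length-replicate j)) (heights-ones-∷ʳ-0 j)

  mergeStep-overflow : ∀ j → mergeStep (heights (ones j) ∷ʳ 0) ≡ nothing
  mergeStep-overflow j rewrite heights-ones-∷ʳ-0 j = mergeStep-downFrom (suc j)

  mergeStep-carry : ∀ xs j → mergeStep (heights (xs ++ false ∷ ones j) ∷ʳ 0)
                             ≡ just (heights (xs ++ true ∷ zeros j) , suc j)
  mergeStep-carry [] j = begin
    mergeStep (length (ones j) ∷ (heights (ones j) ∷ʳ 0))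
      ≡⟨ cong₂ (λ l hs → mergeStep (l ∷ hs)) (length-replicate j) (heights-ones-∷ʳ-0 j) ⟩
    mergeStep (j ∷ j ∷ downFrom j)
      ≡⟨ mergeStep-pair j (downFrom j) (mergeStep-downFrom (suc j)) ⟩
    just (suc j ∷ downFrom j , suc (length (downFrom j)))
      ≡⟨ cong (λ l → just (suc j ∷ downFrom j , suc l)) (length-downFrom j) ⟩
    just (suc j ∷ downFrom j , suc j)
      ≡⟨ cong₂ (λ l hs → just (suc l ∷ hs , suc j)) (length-replicate j) (heights-zeros j) ⟨
    just (heights (true ∷ zeros j) , suc j) ∎
    where open ≡-Reasoning
  mergeStep-carry (x ∷ xs) j rewrite length-carry xs j =
    mergeStep-∷-just _ (heights (xs ++ false ∷ ones j) ∷ʳ 0) (mergeStep-carry xs j)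

  data CounterView : List Bool → Set where
    overflow : ∀ j → CounterView (ones j)
    carry    : ∀ xs j → CounterView (xs ++ false ∷ ones j)

  counterView : ∀ bs → CounterView bs
  counterView [] = overflow 0
  counterView (b ∷ bs) with b | counterView bs
  ... | b     | carry xs j = carry (b ∷ xs) j
  ... | false | overflow j = carry [] j
  ... | true  | overflow j = overflow (suc j)

  -- A carry through j ones is an append with a merge: the merge peak and
  -- j + 1 recomputed range nodes.
  increment : List Bool → List Bool × ℕ
  increment bs with counterView bs
  ... | overflow j = zeros (suc j) , 1
  ... | carry xs j = xs ++ true ∷ zeros j , suc (suc j)

  append-heights : ∀ bs → append (heights bs)
                          ≡ (heights (proj₁ (increment bs)) , proj₂ (increment bs))
  append-heights bs with counterView bs
  ... | overflow j rewrite mergeStep-overflow j =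
    cong (_, 1) (trans (heights-ones-∷ʳ-0 j) (sym (heights-zeros (suc j))))
  ... | carry xs j rewrite mergeStep-carry xs j = refl

  bits : ℕ → List Bool
  bits zero = []
  bits (suc n) = proj₁ (increment (bits n))

  mmb≡heights-bits : ∀ n → mmb n ≡ heights (bits n)
  mmb≡heights-bits zero = refl
  mmb≡heights-bits (suc n) rewrite mmb≡heights-bits n | append-heights (bits n) = refl

  cost-suc : ∀ n → cost (suc n) ≡ proj₂ (increment (bits n))
  cost-suc n rewrite mmb≡heights-bits n | append-heights (bits n) = refl

  value : List Bool → ℕ
  value [] = 0
  value (b ∷ bs) = bit b * 2 ^ length bs + value bs

  2^suc≡2^+2^ : ∀ n → 2 ^ suc n ≡ 2 ^ n + 2 ^ n
  2^suc≡2^+2^ n = cong (2 ^ n +_) (+-identityʳ (2 ^ n))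

  bit-*-≤ : ∀ b p → bit b * p ≤ p
  bit-*-≤ false p = z≤n
  bit-*-≤ true p = ≤-reflexive (+-identityʳ p)

  value-< : ∀ bs → value bs < 2 ^ length bs
  value-< [] = s≤s z≤n
  value-< (b ∷ bs) = begin-strict
    bit b * 2 ^ length bs + value bs <⟨ +-mono-≤-< (bit-*-≤ b (2 ^ length bs)) (value-< bs) ⟩
    2 ^ length bs + 2 ^ length bs    ≡⟨ 2^suc≡2^+2^ (length bs) ⟨
    2 ^ suc (length bs)              ∎
    where open ≤-Reasoning

  2^length≤value : ∀ bs → 2 ^ length bs ≤ value (true ∷ bs)
  2^length≤value bs = ≤-trans (≤-reflexive (sym (*-identityˡ _))) (m≤m+n _ (value bs))

  value-++ : ∀ xs ys → value (xs ++ ys) ≡ value xs * 2 ^ length ys + value ys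
  value-++ [] ys = refl
  value-++ (x ∷ xs) ys = begin
    bit x * 2 ^ length (xs ++ ys) + value (xs ++ ys)
      ≡⟨ cong₂ (λ l v → bit x * 2 ^ l + v) (length-++ xs) (value-++ xs ys) ⟩
    bit x * 2 ^ (length xs + length ys) + (value xs * 2 ^ length ys + value ys)
      ≡⟨ cong (λ p → bit x * p + (value xs * 2 ^ length ys + value ys))
              (^-distribˡ-+-* 2 (length xs) (length ys)) ⟩
    bit x * (2 ^ length xs * 2 ^ length ys) + (value xs * 2 ^ length ys + value ys)
      ≡⟨ distrib (bit x) (2 ^ length xs) (2 ^ length ys) (value xs) (value ys) ⟩
    (bit x * 2 ^ length xs + value xs) * 2 ^ length ys + value ys ∎
    where
    open ≡-Reasoning
    distrib : ∀ b p q v w → b * (p * q) + (v * q + w) ≡ (b * p + v) * q + w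
    distrib = solve-∀

  value-ones : ∀ j → suc (value (ones j)) ≡ 2 ^ j
  value-ones zero = refl
  value-ones (suc j) = begin
    suc (1 * 2 ^ length (ones j) + value (ones j))
      ≡⟨ +-suc _ _ ⟨
    1 * 2 ^ length (ones j) + suc (value (ones j))
      ≡⟨ cong₂ (λ l v → 1 * 2 ^ l + v) (length-replicate j) (value-ones j) ⟩
    1 * 2 ^ j + 2 ^ j
      ≡⟨ cong (_+ 2 ^ j) (*-identityˡ (2 ^ j)) ⟩
    2 ^ j + 2 ^ j
      ≡⟨ 2^suc≡2^+2^ j ⟨
    2 ^ suc j ∎
    where open ≡-Reasoning

  value-zeros : ∀ j → value (zeros j) ≡ 0
  value-zeros zero = refl
  value-zeros (suc j) = value-zeros j

  value-true∷zeros : ∀ j → value (true ∷ zeros j) ≡ 2 ^ j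
  value-true∷zeros j rewrite length-replicate j {false} | value-zeros j =
    trans (+-identityʳ _) (*-identityˡ _)

  value-increment : ∀ bs → value (true ∷ proj₁ (increment bs)) ≡ suc (value (true ∷ bs))
  value-increment bs with counterView bs
  ... | overflow j = trans (value-true∷zeros (suc j)) (sym (value-ones (suc j)))
  ... | carry xs j = begin
    value (true ∷ xs ++ true ∷ zeros j)
      ≡⟨ value-++ (true ∷ xs) (true ∷ zeros j) ⟩
    value (true ∷ xs) * 2 ^ suc (length (zeros j)) + value (true ∷ zeros j)
      ≡⟨ cong₂ (λ l v → value (true ∷ xs) * 2 ^ suc l + v) (length-zeros≡length-ones j)
               (trans (value-true∷zeros j) (sym (value-ones j))) ⟩
    value (true ∷ xs) * 2 ^ suc (length (ones j)) + suc (value (ones j))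
      ≡⟨ +-suc _ _ ⟩
    suc (value (true ∷ xs) * 2 ^ suc (length (ones j)) + value (false ∷ ones j))
      ≡⟨ cong suc (value-++ (true ∷ xs) (false ∷ ones j)) ⟨
    suc (value (true ∷ xs ++ false ∷ ones j)) ∎
    where open ≡-Reasoning

  bits-value : ∀ n → value (true ∷ bits n) ≡ suc n
  bits-value zero = refl
  bits-value (suc n) = trans (value-increment (bits n)) (cong suc (bits-value n))

  increment-cost-≤ : ∀ bs → proj₂ (increment bs) ≤ suc (length bs)
  increment-cost-≤ bs with counterView bs
  ... | overflow j = s≤s z≤n
  ... | carry xs j = s≤s (begin
    suc j                               ≡⟨ cong suc (length-replicate j) ⟨
    length (false ∷ ones j)             ≤⟨ m≤n+m _ (length xs) ⟩
    length xs + length (false ∷ ones j) ≡⟨ length-++ xs ⟨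
    length (xs ++ false ∷ ones j)       ∎)
    where open ≤-Reasoning

  length-bits-≤ : ∀ n → length (bits n) ≤ ⌊log₂ suc n ⌋
  length-bits-≤ n = begin
    length (bits n)               ≡⟨ ⌊log₂[2^n]⌋≡n (length (bits n)) ⟨
    ⌊log₂ 2 ^ length (bits n) ⌋   ≤⟨ ⌊log₂⌋-mono-≤ (2^length≤value (bits n)) ⟩
    ⌊log₂ value (true ∷ bits n) ⌋ ≡⟨ cong ⌊log₂_⌋ (bits-value n) ⟩
    ⌊log₂ suc n ⌋                 ∎
    where open ≤-Reasoning

  cost-≤-log : (n : ℕ) → 1 ≤ n → cost n ≤ ⌊log₂ (n + 1) ⌋ + 1
  cost-≤-log (suc m) _ = begin
    cost (suc m)               ≡⟨ cost-suc m ⟩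
    proj₂ (increment (bits m)) ≤⟨ increment-cost-≤ (bits m) ⟩
    suc (length (bits m))      ≤⟨ s≤s (length-bits-≤ m) ⟩
    suc ⌊log₂ suc m ⌋          ≤⟨ s≤s (⌊log₂⌋-mono-≤ (n≤1+n (suc m))) ⟩
    suc ⌊log₂ suc (suc m) ⌋    ≡⟨ cong (λ k → suc ⌊log₂ k ⌋) (+-comm 1 (suc m)) ⟩
    suc ⌊log₂ (suc m + 1) ⌋    ≡⟨ +-comm 1 _ ⟩
    ⌊log₂ (suc m + 1) ⌋ + 1    ∎
    where open ≤-Reasoning

  popcount : List Bool → ℕ
  popcount [] = 0
  popcount (b ∷ bs) = bit b + popcount bs

  popcount-++ : ∀ xs ys → popcount (xs ++ ys) ≡ popcount xs + popcount ys
  popcount-++ [] ys = refl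
  popcount-++ (x ∷ xs) ys = trans (cong (bit x +_) (popcount-++ xs ys)) (sym (+-assoc (bit x) _ _))

  popcount-ones : ∀ j → popcount (ones j) ≡ j
  popcount-ones zero = refl
  popcount-ones (suc j) = cong suc (popcount-ones j)

  popcount-zeros : ∀ j → popcount (zeros j) ≡ 0
  popcount-zeros zero = refl
  popcount-zeros (suc j) = popcount-zeros j

  popcount-≤-length : ∀ bs → popcount bs ≤ length bs
  popcount-≤-length [] = z≤n
  popcount-≤-length (false ∷ bs) = m≤n⇒m≤1+n (popcount-≤-length bs)
  popcount-≤-length (true ∷ bs) = s≤s (popcount-≤-length bs)

  widthPotential : ℕ → ℕ
  widthPotential zero = 0
  widthPotential (suc K) = widthPotential K + suc (suc K)

  potential : List Bool → ℕ
  potential bs = popcount bs + widthPotential (length bs)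

  potential-increment : ∀ bs → proj₂ (increment bs) + potential (proj₁ (increment bs))
                               ≡ potential bs + 3
  potential-increment bs with counterView bs
  ... | overflow j
    rewrite popcount-zeros j | popcount-ones j
          | length-replicate j {false} | length-replicate j {true}
    = overflow-balance j (widthPotential j)
    where
    overflow-balance : ∀ j w → 1 + (w + suc (suc j)) ≡ j + w + 3
    overflow-balance = solve-∀
  ... | carry xs j
    rewrite length-carry xs j | popcount-++ xs (true ∷ zeros j) | popcount-++ xs (false ∷ ones j)
          | popcount-zeros j | popcount-ones j
    = carry-balance j (popcount xs) (widthPotential (length (xs ++ false ∷ ones j)))
    where
    carry-balance : ∀ j p w → suc (suc j) + (p + 1 + w) ≡ p + j + w + 3
    carry-balance = solve-∀

  totalCost+potential : ∀ n → totalCost n + potential (bits n) ≡ 3 * n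
  totalCost+potential zero = refl
  totalCost+potential (suc n) = begin
    totalCost n + cost (suc n) + potential (bits (suc n))
      ≡⟨ cong (λ c → totalCost n + c + potential (bits (suc n))) (cost-suc n) ⟩
    totalCost n + proj₂ (increment (bits n)) + potential (proj₁ (increment (bits n)))
      ≡⟨ +-assoc (totalCost n) _ _ ⟩
    totalCost n + (proj₂ (increment (bits n)) + potential (proj₁ (increment (bits n))))
      ≡⟨ cong (totalCost n +_) (potential-increment (bits n)) ⟩
    totalCost n + (potential (bits n) + 3)
      ≡⟨ +-assoc (totalCost n) _ 3 ⟨
    totalCost n + potential (bits n) + 3
      ≡⟨ cong (_+ 3) (totalCost+potential n) ⟩
    3 * n + 3
      ≡⟨ +-comm (3 * n) 3 ⟩
    3 + 3 * n
      ≡⟨ *-suc 3 n ⟨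
    3 * suc n ∎
    where open ≡-Reasoning

  width-≤ : ∀ K → K + widthPotential K ≤ (K + 3) * (K + 3)
  width-≤ zero = z≤n
  width-≤ (suc K) = begin
    suc K + (widthPotential K + suc (suc K)) ≡⟨ regroup K (widthPotential K) ⟩
    K + widthPotential K + (K + 3)           ≤⟨ +-mono-≤ (width-≤ K) (m≤m+n (K + 3) (K + 4)) ⟩
    (K + 3) * (K + 3) + (K + 3 + (K + 4))    ≡⟨ expand K ⟩
    (suc K + 3) * (suc K + 3)                ∎
    where
    open ≤-Reasoning
    regroup : ∀ K w → suc K + (w + suc (suc K)) ≡ K + w + (K + 3)
    regroup = solve-∀
    expand : ∀ K → (K + 3) * (K + 3) + (K + 3 + (K + 4)) ≡ (suc K + 3) * (suc K + 3)
    expand = solve-∀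

  potential-≤ : ∀ bs → potential bs ≤ (length bs + 3) * (length bs + 3)
  potential-≤ bs = ≤-trans (+-monoˡ-≤ _ (popcount-≤-length bs)) (width-≤ (length bs))

  n<2^n : ∀ n → n < 2 ^ n
  n<2^n zero = s≤s z≤n
  n<2^n (suc n) = begin-strict
    1 + n         <⟨ +-mono-≤-< (m^n>0 2 n) (n<2^n n) ⟩
    2 ^ n + 2 ^ n ≡⟨ 2^suc≡2^+2^ n ⟨
    2 ^ suc n     ∎
    where open ≤-Reasoning

  2^-cancel-< : ∀ m n → 2 ^ m < 2 ^ n → m < n
  2^-cancel-< m n 2^m<2^n = ≰⇒> (λ n≤m → <⇒≱ 2^m<2^n (^-monoʳ-≤ 2 n≤m))

  -- At K₀ = 3 j with j = 9 d + 1 the bound follows from j + 1 ≤ 2 ^ j, and it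
  -- propagates upwards since (K + 4) ^ 2 ≤ 2 (K + 3) ^ 2.
  square-negligible : ∀ d → ∃[ K₀ ] (∀ K → K₀ ≤ K → (K + 3) * (K + 3) * d + 2 ≤ 2 ^ K)
  square-negligible d = j * 3 , λ K K₀≤K → above (≤⇒≤′ K₀≤K)
    where
    j = suc (9 * d)
    P : ℕ → Set
    P K = (K + 3) * (K + 3) * d + 2 ≤ 2 ^ K
    base : P (j * 3)
    base = begin
      (j * 3 + 3) * (j * 3 + 3) * d + 2
        ≤⟨ +-monoʳ-≤ _ (*-monoʳ-≤ 2 1≤square) ⟩
      (j * 3 + 3) * (j * 3 + 3) * d + 2 * (suc j * suc j)
        ≡⟨ cube d ⟩
      suc j ^ 3
        ≤⟨ ^-monoˡ-≤ 3 (n<2^n j) ⟩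
      (2 ^ j) ^ 3
        ≡⟨ ^-*-assoc 2 j 3 ⟩
      2 ^ (j * 3) ∎
      where
      open ≤-Reasoning
      1≤square : 1 ≤ suc j * suc j
      1≤square = s≤s z≤n
      cube : ∀ d → let j = suc (9 * d) in
             (j * 3 + 3) * (j * 3 + 3) * d + 2 * (suc j * suc j) ≡ suc j * (suc j * (suc j * 1))
      cube = solve-∀
    step : ∀ K → P K → P (suc K)
    step K h = begin
      (suc K + 3) * (suc K + 3) * d + 2
        ≤⟨ m≤m+n _ ((K * K + 4 * K + 2) * d + 2) ⟩
      (suc K + 3) * (suc K + 3) * d + 2 + ((K * K + 4 * K + 2) * d + 2)
        ≡⟨ expand K d ⟩
      2 * ((K + 3) * (K + 3) * d + 2)
        ≤⟨ *-monoʳ-≤ 2 h ⟩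
      2 * 2 ^ K ∎
      where
      open ≤-Reasoning
      expand : ∀ K d → (suc K + 3) * (suc K + 3) * d + 2 + ((K * K + 4 * K + 2) * d + 2)
                       ≡ 2 * ((K + 3) * (K + 3) * d + 2)
      expand = solve-∀
    above : ∀ {K} → j * 3 ≤′ K → P K
    above ≤′-refl = base
    above (≤′-step {K} h) = step K (above h)

  potential-negligible : ∀ d → ∃[ N₀ ] (∀ M → N₀ ≤ M → potential (bits (suc M)) * d < suc M)
  potential-negligible d with square-negligible d
  ... | K₀ , negligible = 2 ^ K₀ , small
    where
    small : ∀ M → 2 ^ K₀ ≤ M → potential (bits (suc M)) * d < suc M
    small M 2^K₀≤M = s≤s (+-cancelʳ-≤ 2 _ M (begin
      potential bs * d + 2      ≤⟨ +-monoˡ-≤ 2 (*-monoˡ-≤ d (potential-≤ bs)) ⟩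
      (K + 3) * (K + 3) * d + 2 ≤⟨ negligible K K₀≤K ⟩
      2 ^ K                     ≤⟨ 2^length≤value bs ⟩
      value (true ∷ bs)         ≡⟨ bits-value (suc M) ⟩
      suc (suc M)               ≡⟨ +-comm 2 M ⟩
      M + 2                     ∎))
      where
      open ≤-Reasoning
      bs = bits (suc M)
      K = length bs
      K₀≤K : K₀ ≤ K
      K₀≤K = ≤-pred (2^-cancel-< K₀ (suc K) (begin-strict
        2 ^ K₀            ≤⟨ 2^K₀≤M ⟩
        M                 <⟨ n≤1+n (suc M) ⟩
        suc (suc M)       ≡⟨ bits-value (suc M) ⟨
        value (true ∷ bs) <⟨ value-< (true ∷ bs) ⟩
        2 ^ suc K         ∎))

module Average where
  open import Defs
  open import Data.Nat as ℕ using (ℕ; suc; _+_; _*_; _≤_)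
  import Data.Nat.Properties as ℕ
  open import Data.Integer as ℤ using (+_; +[1+_]; -[1+_])
  import Data.Integer.Properties as ℤ
  open import Data.Integer.Tactic.RingSolver using (solve-∀)
  open import Data.Product using (_,_; ∃-syntax)
  open import Data.Rational using (ℚ; mkℚ; Positive; ∣_∣; -_; _-_; _<_; _/_; toℚᵘ)
  open import Data.Rational.Properties
    using (toℚᵘ-cancel-<; toℚᵘ-homo-∣-∣; toℚᵘ-homo-+; toℚᵘ-homo‿-; toℚᵘ-fromℚᵘ)
  open import Data.Rational.Unnormalised as ℚᵘ using (mkℚᵘ; *≡*; *<*)
  import Data.Rational.Unnormalised.Properties as ℚᵘ
  open import Relation.Binary.PropositionalEquality

  open BinaryCounter using (bits; potential; totalCost+potential; potential-negligible)

  toℚᵘ-distance : ∀ t M c → toℚᵘ ∣ (+ t) / suc M - (+ c) / 1 ∣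
                            ℚᵘ.≃ ℚᵘ.∣ mkℚᵘ (+ t) M ℚᵘ.- mkℚᵘ (+ c) 0 ∣
  toℚᵘ-distance t M c = begin
    toℚᵘ ∣ t/sM - c/1 ∣
      ≈⟨ toℚᵘ-homo-∣-∣ (t/sM - c/1) ⟩
    ℚᵘ.∣ toℚᵘ (t/sM - c/1) ∣
      ≈⟨ ℚᵘ.∣-∣-cong (toℚᵘ-homo-+ t/sM (- c/1)) ⟩
    ℚᵘ.∣ toℚᵘ t/sM ℚᵘ.+ toℚᵘ (- c/1) ∣
      ≈⟨ ℚᵘ.∣-∣-cong (ℚᵘ.+-congʳ (toℚᵘ t/sM) (toℚᵘ-homo‿- c/1)) ⟩
    ℚᵘ.∣ toℚᵘ t/sM ℚᵘ.- toℚᵘ c/1 ∣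
      ≈⟨ ℚᵘ.∣-∣-cong (ℚᵘ.+-cong (toℚᵘ-fromℚᵘ (mkℚᵘ (+ t) M))
                                (ℚᵘ.-‿cong (toℚᵘ-fromℚᵘ (mkℚᵘ (+ c) 0)))) ⟩
    ℚᵘ.∣ mkℚᵘ (+ t) M ℚᵘ.- mkℚᵘ (+ c) 0 ∣ ∎
    where
    open ℚᵘ.≃-Reasoning
    t/sM c/1 : ℚ
    t/sM = (+ t) / suc M
    c/1 = (+ c) / 1

  distance-complement : ∀ t φ c M → t + φ ≡ c * suc M →
                        ℚᵘ.∣ mkℚᵘ (+ t) M ℚᵘ.- mkℚᵘ (+ c) 0 ∣ ℚᵘ.≃ mkℚᵘ (+ φ) M
  distance-complement t φ c M t+φ≡c*sM = *≡* (begin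
    + ℤ.∣ + t ℤ.* + 1 ℤ.+ ℤ.- + c ℤ.* + suc M ∣ ℤ.* + suc M
      ≡⟨ cong (λ i → + ℤ.∣ i ∣ ℤ.* + suc M) numerator ⟩
    + ℤ.∣ ℤ.- + φ ∣ ℤ.* + suc M
      ≡⟨ cong (λ n → + n ℤ.* + suc M) (ℤ.∣-i∣≡∣i∣ (+ φ)) ⟩
    + φ ℤ.* + suc M
      ≡⟨ cong (λ n → + φ ℤ.* + n) (ℕ.*-identityʳ (suc M)) ⟨
    + φ ℤ.* + (suc M * 1) ∎)
    where
    open ≡-Reasoning
    regroup : ∀ t c n → t ℤ.* + 1 ℤ.+ ℤ.- c ℤ.* n ≡ t ℤ.- c ℤ.* n
    regroup = solve-∀
    cancel : ∀ t φ → t ℤ.- (t ℤ.+ φ) ≡ ℤ.- φ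
    cancel = solve-∀
    numerator : + t ℤ.* + 1 ℤ.+ ℤ.- + c ℤ.* + suc M ≡ ℤ.- + φ
    numerator = begin
      + t ℤ.* + 1 ℤ.+ ℤ.- + c ℤ.* + suc M ≡⟨ regroup (+ t) (+ c) (+ suc M) ⟩
      + t ℤ.- + c ℤ.* + suc M             ≡⟨ cong (λ u → + t ℤ.- u) (ℤ.pos-* c (suc M)) ⟨
      + t ℤ.- + (c * suc M)               ≡⟨ cong (λ u → + t ℤ.- + u) t+φ≡c*sM ⟨
      + t ℤ.- + (t + φ)                   ≡⟨ cong (λ u → + t ℤ.- u) (ℤ.pos-+ t φ) ⟩
      + t ℤ.- (+ t ℤ.+ + φ)               ≡⟨ cancel (+ t) (+ φ) ⟩
      ℤ.- + φ                             ∎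

  average-deviation : ∀ M → toℚᵘ ∣ average M - (+ 3) / 1 ∣
                            ℚᵘ.≃ mkℚᵘ (+ potential (bits (suc M))) M
  average-deviation M =
    ℚᵘ.≃-trans (toℚᵘ-distance (totalCost (suc M)) M 3)
               (distance-complement (totalCost (suc M)) (potential (bits (suc M))) 3 M
                                    (totalCost+potential (suc M)))

  mkℚᵘ-< : ∀ a m p d → a * suc d ℕ.< suc m → mkℚᵘ (+ a) m ℚᵘ.< mkℚᵘ +[1+ p ] d
  mkℚᵘ-< a m p d a*sd<sm =
    *<* (subst₂ ℤ._<_ (ℤ.pos-* a (suc d)) (ℤ.pos-* (suc p) (suc m))
                (ℤ.+<+ (ℕ.<-≤-trans a*sd<sm (ℕ.m≤n*m (suc m) (suc p)))))

  average-converges : (ε : ℚ) → Positive ε →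
                      ∃[ N₀ ] ((M : ℕ) → N₀ ≤ M → ∣ average M - (+ 3) / 1 ∣ < ε)
  average-converges (mkℚ +[1+ p ] d _) _ with potential-negligible (suc d)
  ... | N₀ , negligible = N₀ , λ M N₀≤M →
    toℚᵘ-cancel-< (ℚᵘ.<-respˡ-≃ (ℚᵘ.≃-sym (average-deviation M))
                                (mkℚᵘ-< _ M p d (negligible M N₀≤M)))
  average-converges (mkℚ (+ 0) _ _) ()
  average-converges (mkℚ -[1+ _ ] _ _) ()

open import Defs
open import Data.Nat using (ℕ; _+_; _≤_)
open import Data.Nat.Logarithm using (⌊log₂_⌋)
open import Data.Product using (_×_; _,_; ∃-syntax)
open import Data.Rational using (ℚ; Positive; ∣_∣; _-_; _<_; _/_)
open import Data.Integer using (+_)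

lemma9 : ((n : ℕ) → 1 ≤ n → cost n ≤ ⌊log₂ (n + 1) ⌋ + 1)
    × ((ε : ℚ) → Positive ε → ∃[ N₀ ] ((M : ℕ) → N₀ ≤ M → ∣ average M - (+ 3) / 1 ∣ < ε))
lemma9 = BinaryCounter.cost-≤-log , Average.average-converges
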